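{- Let $\mathbb F$ be a field, $\beta,\gamma,\gamma^*,\varrho,\varrho^*\in\mathbb F$, and $\mathbb T=\mathbb T(\beta,\gamma,\gamma^*,\varrho,\varrho^*)$. Then the elements $A_1^hA_2^iA_3^j{A^*_1}^r{A^*_2}^s{A^*_3}^t$ ($h,i,j,r,s,t\in\mathbb N$) are linearly independent in $\mathbb T$, and the elements ${A^*_1}^h{A^*_2}^i{A^*_3}^jA_1^rA_2^sA_3^t$ ($h,i,j,r,s,t\in\mathbb N$) are linearly independent in $\mathbb T$.
   Context: $\mathbb T(\beta,\gamma,\gamma^*,\varrho,\varrho^*)$ is the associative unital $\mathbb F$-algebra with generators $A_i,A^*_i$ ($i\in\{1,2,3\}$) and relations $[A_i,A_j]=0$, $[A^*_i,A^*_j]=0$ for all $i,j$; $[A_i,A^*_i]=0$ for all $i$; and for distinct $i,j$: $[A_i,A_i^2A_j^*-\beta A_iA_j^*A_i+A_j^*A_i^2-\gamma(A_iA_j^*+A_j^*A_i)-\varrho A_j^*]=0$ and $[A_j^*,A_j^{*2}A_i-\beta A_j^*A_iA_j^*+A_iA_j^{*2}-\gamma^*(A_j^*A_i+A_iA_j^*)-\varrho^*A_i]=0$, where $[B,C]=BC-CB$. $\mathbb N=\{0,1,2,\dots\}$. -}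

module Defs where

open import Level using (Level; _⊔_) renaming (suc to lsuc)
open import Algebra.Bundles using (CommutativeRing)
open import Data.Nat using (ℕ; zero; suc)
open import Data.Fin using (Fin; zero; suc)
open import Data.Vec using (Vec; []; _∷_)
open import Data.Product using (∃)
open import Relation.Nullary using (¬_)
open import Relation.Binary.PropositionalEquality using (_≡_; _≢_)
open import Function.Definitions using (Injective)

record Field (c ℓ : Level) : Set (lsuc (c ⊔ ℓ)) where
  field
    commutativeRing : CommutativeRing c ℓ
  open CommutativeRing commutativeRing public
  field
    1#≉0#   : ¬ (1# ≈ 0#)
    inverse : ∀ x → ¬ (x ≈ 0#) → ∃ λ y → x * y ≈ 1#

-- The algebra T(β,γ,γ*,ϱ,ϱ*) given by generators and relations:
-- terms of the free unital associative F-algebra on A₁,A₂,A₃,A*₁,A*₂,A*₃,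
-- modulo the smallest congruence containing the algebra axioms and the
-- defining relations.  Equality in T is the setoid relation _≋_.
module Presentation {c ℓ} (F : Field c ℓ) (β γ γ* ϱ ϱ* : Field.Carrier F) where
  open Field F using (Carrier; _≈_; _+_; _*_; -_; 0#; 1#)

  data Gen : Set where
    𝐀 𝐀* : Fin 3 → Gen

  infixl 6 _⊕_
  infixl 7 _⊗_

  data Term : Set c where
    gen : Gen → Term
    sc  : Carrier → Term          -- the scalar a·1 of T
    _⊕_ : Term → Term → Term
    _⊗_ : Term → Term → Term

  𝟘 𝟙 : Term
  𝟘 = sc 0#
  𝟙 = sc 1#

  _·_ : Carrier → Term → Term
  a · x = sc a ⊗ x
  infixr 8 _·_

  _⊖_ : Term → Term → Term
  x ⊖ y = x ⊕ (- 1#) · y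
  infixl 6 _⊖_

  ⟦_,_⟧ : Term → Term → Term
  ⟦ x , y ⟧ = x ⊗ y ⊖ y ⊗ x

  A A* : Fin 3 → Term
  A  i = gen (𝐀 i)
  A* i = gen (𝐀* i)

  infix 4 _≋_
  data _≋_ : Term → Term → Set (c ⊔ ℓ) where
    ≋-refl  : ∀ {x} → x ≋ x
    ≋-sym   : ∀ {x y} → x ≋ y → y ≋ x
    ≋-trans : ∀ {x y z} → x ≋ y → y ≋ z → x ≋ z
    T-⊕-cong : ∀ {x x′ y y′} → x ≋ x′ → y ≋ y′ → x ⊕ y ≋ x′ ⊕ y′
    T-⊗-cong : ∀ {x x′ y y′} → x ≋ x′ → y ≋ y′ → x ⊗ y ≋ x′ ⊗ y′
    T-⊕-assoc     : ∀ x y z → (x ⊕ y) ⊕ z ≋ x ⊕ (y ⊕ z)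
    T-⊕-comm      : ∀ x y → x ⊕ y ≋ y ⊕ x
    T-⊕-identityˡ : ∀ x → 𝟘 ⊕ x ≋ x
    T-⊕-inverse   : ∀ x → x ⊖ x ≋ 𝟘
    T-⊗-assoc     : ∀ x y z → (x ⊗ y) ⊗ z ≋ x ⊗ (y ⊗ z)
    T-⊗-identityˡ : ∀ x → 𝟙 ⊗ x ≋ x
    T-⊗-identityʳ : ∀ x → x ⊗ 𝟙 ≋ x
    T-distribˡ    : ∀ x y z → x ⊗ (y ⊕ z) ≋ x ⊗ y ⊕ x ⊗ z
    T-distribʳ    : ∀ x y z → (y ⊕ z) ⊗ x ≋ y ⊗ x ⊕ z ⊗ x
    sc-cong     : ∀ {a b} → a ≈ b → sc a ≋ sc b
    sc-+        : ∀ a b → sc (a + b) ≋ sc a ⊕ sc b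
    sc-*        : ∀ a b → sc (a * b) ≋ sc a ⊗ sc b
    sc-central  : ∀ a x → sc a ⊗ x ≋ x ⊗ sc a
    rel-AA    : ∀ i j → ⟦ A i , A j ⟧ ≋ 𝟘
    rel-A*A*  : ∀ i j → ⟦ A* i , A* j ⟧ ≋ 𝟘
    rel-AA*   : ∀ i → ⟦ A i , A* i ⟧ ≋ 𝟘
    rel-TD    : ∀ i j → i ≢ j →
      ⟦ A i , A i ⊗ A i ⊗ A* j ⊖ β · (A i ⊗ A* j ⊗ A i) ⊕ A* j ⊗ A i ⊗ A i
              ⊖ γ · (A i ⊗ A* j ⊕ A* j ⊗ A i) ⊖ ϱ · A* j ⟧ ≋ 𝟘
    rel-TD*   : ∀ i j → i ≢ j →
      ⟦ A* j , A* j ⊗ A* j ⊗ A i ⊖ β · (A* j ⊗ A i ⊗ A* j) ⊕ A i ⊗ A* j ⊗ A* j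
               ⊖ γ* · (A* j ⊗ A i ⊕ A i ⊗ A* j) ⊖ ϱ* · A i ⟧ ≋ 𝟘

  _^_ : Term → ℕ → Term
  x ^ zero  = 𝟙
  x ^ suc n = x ⊗ (x ^ n)

  A₁ A₂ A₃ A*₁ A*₂ A*₃ : Term
  A₁ = A zero
  A₂ = A (suc zero)
  A₃ = A (suc (suc zero))
  A*₁ = A* zero
  A*₂ = A* (suc zero)
  A*₃ = A* (suc (suc zero))

  mon₁ : Vec ℕ 6 → Term
  mon₁ (h ∷ i ∷ j ∷ r ∷ s ∷ t ∷ []) =
    A₁ ^ h ⊗ A₂ ^ i ⊗ A₃ ^ j ⊗ A*₁ ^ r ⊗ A*₂ ^ s ⊗ A*₃ ^ t

  mon₂ : Vec ℕ 6 → Term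
  mon₂ (h ∷ i ∷ j ∷ r ∷ s ∷ t ∷ []) =
    A*₁ ^ h ⊗ A*₂ ^ i ⊗ A*₃ ^ j ⊗ A₁ ^ r ⊗ A₂ ^ s ⊗ A₃ ^ t

  lincomb : ∀ {I : Set} (f : I → Term) (n : ℕ) → (Fin n → I) → (Fin n → Carrier) → Term
  lincomb f zero    idx cs = 𝟘
  lincomb f (suc n) idx cs = cs zero · f (idx zero) ⊕ lincomb f n (λ k → idx (suc k)) (λ k → cs (suc k))

  LinearlyIndependent : ∀ {I : Set} → (I → Term) → Set (c ⊔ ℓ)
  LinearlyIndependent {I} f =
    ∀ (n : ℕ) (idx : Fin n → I) → Injective _≡_ _≡_ idx →
    (cs : Fin n → Carrier) → lincomb f n idx cs ≋ 𝟘 → ∀ k → cs k ≈ 0#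

{-# OPTIONS --safe #-}
-- Every defining relation of T is a commutator [G , x] with G a generator, so
-- T maps onto the commutative polynomial ring F[x₁,…,x₆], each generator going
-- to a variable.  Concretely, T acts on coefficient functions ℕ⁶ → F with the
-- generators acting as multiplication by variables, i.e. as shifts of the
-- exponent vector; shifts commute with each other and with scalars, hence with
-- the action of every term, so all relations hold.  Applied to the constant 1,
-- each monomial of the theorem yields the Kronecker delta at its own exponent
-- vector; evaluating the image of a vanishing linear combination at the
-- exponent vector of one of its monomials recovers that coefficient.  The two
-- families differ only in which generators are sent to the first three
-- variables.
module Submission where

open import Defs
open import Algebra.Bundles using (CommutativeRing)
import Algebra.Properties.CommutativeSemigroup as CommutativeSemigroupProperties
import Algebra.Properties.Ring as RingProperties
open import Data.Bool using (true; false; if_then_else_)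
open import Data.Empty using (⊥-elim)
open import Data.Fin using (Fin; zero; suc; _↑ˡ_; _↑ʳ_)
import Data.Fin.Properties as Fin
open import Data.Nat using (ℕ; zero; suc; _≟_) renaming (_+_ to _+ℕ_)
open import Data.Nat.Properties using (+-suc) renaming (+-identityʳ to +ℕ-identityʳ)
open import Data.Product using (_×_; _,_)
open import Data.Vec using (Vec; []; _∷_; updateAt; replicate)
open import Data.Vec.Properties using (updateAt-id-local; updateAt-updateAt-local)
open import Function using (_∘_)
open import Function.Definitions using (Injective)
open import Relation.Nullary using (does; yes; no)
open import Relation.Nullary.Decidable using (dec-true; dec-false)
open import Relation.Binary.PropositionalEquality as ≡ using (_≡_; _≢_; _≗_)

-- Adding on the right makes raising a zero exponent reduce to k on the nose.
raise : ∀ {n} → Fin n → ℕ → Vec ℕ n → Vec ℕ n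
raise p k v = updateAt v p (_+ℕ k)

raise-zero : ∀ {n} (p : Fin n) v → raise p 0 v ≡ v
raise-zero p v = updateAt-id-local p v (+ℕ-identityʳ _)

raise-suc : ∀ {n} (p : Fin n) k v → updateAt (raise p k v) p suc ≡ raise p (suc k) v
raise-suc p k v = updateAt-updateAt-local p v (≡.sym (+-suc _ k))

module CoefficientFunctions {c ℓ} (R : CommutativeRing c ℓ) where
  open CommutativeRing R

  Coeffs : ℕ → Set c
  Coeffs n = Vec ℕ n → Carrier

  infix 4 _≐_
  _≐_ : ∀ {n} → Coeffs n → Coeffs n → Set ℓ
  f ≐ g = ∀ e → f e ≈ g e

  -- Multiplication by the p-th variable, on coefficient functions of power series.
  shift : ∀ {n} → Fin n → Coeffs n → Coeffs n
  shift zero    f (zero  ∷ e) = 0#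
  shift zero    f (suc a ∷ e) = f (a ∷ e)
  shift (suc p) f (a ∷ e)     = shift p (λ e′ → f (a ∷ e′)) e

  shift-cong : ∀ {n} (p : Fin n) {f g : Coeffs n} → f ≐ g → shift p f ≐ shift p g
  shift-cong zero    f≐g (zero  ∷ e) = refl
  shift-cong zero    f≐g (suc a ∷ e) = f≐g (a ∷ e)
  shift-cong (suc p) f≐g (a ∷ e)     = shift-cong p (λ e′ → f≐g (a ∷ e′)) e

  shift-+ : ∀ {n} (p : Fin n) (f g : Coeffs n) →
            shift p (λ e → f e + g e) ≐ λ e → shift p f e + shift p g e
  shift-+ zero    f g (zero  ∷ e) = sym (+-identityˡ 0#)
  shift-+ zero    f g (suc a ∷ e) = refl
  shift-+ (suc p) f g (a ∷ e)     = shift-+ p (λ e′ → f (a ∷ e′)) (λ e′ → g (a ∷ e′)) e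

  shift-* : ∀ {n} (p : Fin n) a (f : Coeffs n) →
            shift p (λ e → a * f e) ≐ λ e → a * shift p f e
  shift-* zero    a f (zero  ∷ e) = sym (zeroʳ a)
  shift-* zero    a f (suc b ∷ e) = refl
  shift-* (suc p) a f (b ∷ e)     = shift-* p a (λ e′ → f (b ∷ e′)) e

  shift-0 : ∀ {n} (p : Fin n) → shift p (λ _ → 0#) ≗ λ _ → 0#
  shift-0 zero    (zero  ∷ e) = ≡.refl
  shift-0 zero    (suc a ∷ e) = ≡.refl
  shift-0 (suc p) (a ∷ e)     = shift-0 p e

  shift-comm : ∀ {n} (p q : Fin n) (f : Coeffs n) → shift p (shift q f) ≗ shift q (shift p f)
  shift-comm zero    zero    f (zero  ∷ e) = ≡.refl
  shift-comm zero    zero    f (suc a ∷ e) = ≡.refl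
  shift-comm zero    (suc q) f (zero  ∷ e) = ≡.sym (shift-0 q e)
  shift-comm zero    (suc q) f (suc a ∷ e) = ≡.refl
  shift-comm (suc p) zero    f (zero  ∷ e) = shift-0 p e
  shift-comm (suc p) zero    f (suc a ∷ e) = ≡.refl
  shift-comm (suc p) (suc q) f (a ∷ e)     = shift-comm p q (λ e′ → f (a ∷ e′)) e

  δ : ∀ {n} → Vec ℕ n → Coeffs n
  δ []      []      = 1#
  δ (a ∷ v) (b ∷ w) = if does (a ≟ b) then δ v w else 0#

  δ-diag : ∀ {n} (v : Vec ℕ n) → δ v v ≡ 1#
  δ-diag []      = ≡.refl
  δ-diag (a ∷ v) rewrite dec-true (a ≟ a) ≡.refl = δ-diag v

  δ-off-diag : ∀ {n} (v w : Vec ℕ n) → v ≢ w → δ v w ≡ 0#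
  δ-off-diag []      []      v≢w = ⊥-elim (v≢w ≡.refl)
  δ-off-diag (a ∷ v) (b ∷ w) v≢w with a ≟ b
  ... | yes ≡.refl rewrite dec-true (a ≟ a) ≡.refl = δ-off-diag v w (v≢w ∘ ≡.cong (a ∷_))
  ... | no a≢b     rewrite dec-false (a ≟ b) a≢b  = ≡.refl

  shift-δ : ∀ {n} (p : Fin n) v → shift p (δ v) ≗ δ (updateAt v p suc)
  shift-δ zero    (a ∷ v) (zero  ∷ w) = ≡.refl
  shift-δ zero    (a ∷ v) (suc b ∷ w) = ≡.refl
  shift-δ (suc p) (a ∷ v) (b ∷ w) with does (a ≟ b)
  ... | true  = shift-δ p v w
  ... | false = shift-0 p w

module PolynomialModel {c ℓ} (F : Field c ℓ) (β γ γ* ϱ ϱ* : Field.Carrier F)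
                       {n} (var : Presentation.Gen F β γ γ* ϱ ϱ* → Fin n) where
  open Presentation F β γ γ* ϱ ϱ*
  open Field F using (commutativeRing)
  open CommutativeRing commutativeRing hiding (zero)
  open CoefficientFunctions commutativeRing
  open CommutativeSemigroupProperties +-commutativeSemigroup using () renaming (interchange to +-interchange)
  open import Relation.Binary.Reasoning.Setoid setoid

  ⟦_⟧ : Term → Coeffs n → Coeffs n
  ⟦ gen x ⟧ f   = shift (var x) f
  ⟦ sc a ⟧ f e  = a * f e
  ⟦ x ⊕ y ⟧ f e = ⟦ x ⟧ f e + ⟦ y ⟧ f e
  ⟦ x ⊗ y ⟧ f   = ⟦ x ⟧ (⟦ y ⟧ f)

  ⟦⟧-cong : ∀ x {f g : Coeffs n} → f ≐ g → ⟦ x ⟧ f ≐ ⟦ x ⟧ g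
  ⟦⟧-cong (gen y) f≐g   = shift-cong (var y) f≐g
  ⟦⟧-cong (sc a)  f≐g e = *-congˡ (f≐g e)
  ⟦⟧-cong (x ⊕ y) f≐g e = +-cong (⟦⟧-cong x f≐g e) (⟦⟧-cong y f≐g e)
  ⟦⟧-cong (x ⊗ y) f≐g   = ⟦⟧-cong x (⟦⟧-cong y f≐g)

  ⟦⟧-+ : ∀ x (f g : Coeffs n) → ⟦ x ⟧ (λ e → f e + g e) ≐ λ e → ⟦ x ⟧ f e + ⟦ x ⟧ g e
  ⟦⟧-+ (gen y) f g   = shift-+ (var y) f g
  ⟦⟧-+ (sc a)  f g e = distribˡ a (f e) (g e)
  ⟦⟧-+ (x ⊕ y) f g e = trans (+-cong (⟦⟧-+ x f g e) (⟦⟧-+ y f g e)) (+-interchange _ _ _ _)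
  ⟦⟧-+ (x ⊗ y) f g e = trans (⟦⟧-cong x (⟦⟧-+ y f g) e) (⟦⟧-+ x _ _ e)

  ⟦⟧-* : ∀ x a (f : Coeffs n) → ⟦ x ⟧ (λ e → a * f e) ≐ λ e → a * ⟦ x ⟧ f e
  ⟦⟧-* (gen y) a f   = shift-* (var y) a f
  ⟦⟧-* (sc b)  a f e = begin
    b * (a * f e) ≈⟨ *-assoc b a (f e) ⟨
    b * a * f e   ≈⟨ *-congʳ (*-comm b a) ⟩
    a * b * f e   ≈⟨ *-assoc a b (f e) ⟩
    a * (b * f e) ∎
  ⟦⟧-* (x ⊕ y) a f e = trans (+-cong (⟦⟧-* x a f e) (⟦⟧-* y a f e)) (sym (distribˡ a _ _))
  ⟦⟧-* (x ⊗ y) a f e = trans (⟦⟧-cong x (⟦⟧-* y a f) e) (⟦⟧-* x a _ e)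

  ⟦⟧-shift : ∀ x (p : Fin n) (f : Coeffs n) → ⟦ x ⟧ (shift p f) ≐ shift p (⟦ x ⟧ f)
  ⟦⟧-shift (gen y) p f e = reflexive (shift-comm (var y) p f e)
  ⟦⟧-shift (sc a)  p f e = sym (shift-* p a f e)
  ⟦⟧-shift (x ⊕ y) p f e =
    trans (+-cong (⟦⟧-shift x p f e) (⟦⟧-shift y p f e)) (sym (shift-+ p _ _ e))
  ⟦⟧-shift (x ⊗ y) p f e = trans (⟦⟧-cong x (⟦⟧-shift y p f) e) (⟦⟧-shift x p _ e)

  ⟦⊖⟧-zero : ∀ x y (f : Coeffs n) → ⟦ y ⟧ f ≐ ⟦ x ⟧ f → ⟦ x ⊖ y ⟧ f ≐ ⟦ 𝟘 ⟧ f
  ⟦⊖⟧-zero x y f y≐x e = begin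
    ⟦ x ⟧ f e + - 1# * ⟦ y ⟧ f e ≈⟨ +-congˡ (RingProperties.-1*x≈-x ring _) ⟩
    ⟦ x ⟧ f e + - ⟦ y ⟧ f e      ≈⟨ +-congˡ (-‿cong (y≐x e)) ⟩
    ⟦ x ⟧ f e + - ⟦ x ⟧ f e      ≈⟨ -‿inverseʳ _ ⟩
    0#                            ≈⟨ zeroˡ (f e) ⟨
    0# * f e                      ∎

  ⟦⟧-commutator-gen : ∀ x y (f : Coeffs n) → ⟦ gen x ⊗ y ⊖ y ⊗ gen x ⟧ f ≐ ⟦ 𝟘 ⟧ f
  ⟦⟧-commutator-gen x y f = ⟦⊖⟧-zero (gen x ⊗ y) (y ⊗ gen x) f (⟦⟧-shift y (var x) f)

  ⟦⟧-sound : ∀ {x y} → x ≋ y → ∀ f → ⟦ x ⟧ f ≐ ⟦ y ⟧ f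
  ⟦⟧-sound ≋-refl                    f e = refl
  ⟦⟧-sound (≋-sym x≋y)               f e = sym (⟦⟧-sound x≋y f e)
  ⟦⟧-sound (≋-trans x≋y y≋z)         f e = trans (⟦⟧-sound x≋y f e) (⟦⟧-sound y≋z f e)
  ⟦⟧-sound (T-⊕-cong x≋x′ y≋y′)      f e = +-cong (⟦⟧-sound x≋x′ f e) (⟦⟧-sound y≋y′ f e)
  ⟦⟧-sound (T-⊗-cong {x} {_} {_} {y′} x≋x′ y≋y′) f e =
    trans (⟦⟧-cong x (⟦⟧-sound y≋y′ f) e) (⟦⟧-sound x≋x′ (⟦ y′ ⟧ f) e)
  ⟦⟧-sound (T-⊕-assoc x y z)         f e = +-assoc _ _ _
  ⟦⟧-sound (T-⊕-comm x y)            f e = +-comm _ _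
  ⟦⟧-sound (T-⊕-identityˡ x)         f e = trans (+-congʳ (zeroˡ (f e))) (+-identityˡ _)
  ⟦⟧-sound (T-⊕-inverse x)           f e = ⟦⊖⟧-zero x x f (λ _ → refl) e
  ⟦⟧-sound (T-⊗-assoc x y z)         f e = refl
  ⟦⟧-sound (T-⊗-identityˡ x)         f e = *-identityˡ _
  ⟦⟧-sound (T-⊗-identityʳ x)         f e = ⟦⟧-cong x (λ e → *-identityˡ (f e)) e
  ⟦⟧-sound (T-distribˡ x y z)        f e = ⟦⟧-+ x _ _ e
  ⟦⟧-sound (T-distribʳ x y z)        f e = refl
  ⟦⟧-sound (sc-cong a≈b)             f e = *-congʳ a≈b
  ⟦⟧-sound (sc-+ a b)                f e = distribʳ (f e) a b
  ⟦⟧-sound (sc-* a b)                f e = *-assoc a b (f e)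
  ⟦⟧-sound (sc-central a x)          f e = sym (⟦⟧-* x a f e)
  ⟦⟧-sound (rel-AA i j)              f e = ⟦⟧-commutator-gen (𝐀 i) (A j) f e
  ⟦⟧-sound (rel-A*A* i j)            f e = ⟦⟧-commutator-gen (𝐀* i) (A* j) f e
  ⟦⟧-sound (rel-AA* i)               f e = ⟦⟧-commutator-gen (𝐀 i) (A* i) f e
  -- The implicit pattern binds the (long) inner term of the commutator.
  ⟦⟧-sound {_ ⊗ y ⊕ _} (rel-TD i j _)  f e = ⟦⟧-commutator-gen (𝐀 i) y f e
  ⟦⟧-sound {_ ⊗ y ⊕ _} (rel-TD* i j _) f e = ⟦⟧-commutator-gen (𝐀* j) y f e

  -- A record, not a function type, so that x and σ stay inferable from it.
  record MapsMonomials (x : Term) (σ : Vec ℕ n → Vec ℕ n) : Set ℓ where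
    constructor mapsMonomials
    field on-δ : ∀ v → ⟦ x ⟧ (δ v) ≐ δ (σ v)
  open MapsMonomials public

  infixl 7 _⊗-mapsMonomials_
  _⊗-mapsMonomials_ : ∀ {x y σ τ} →
                      MapsMonomials x σ → MapsMonomials y τ → MapsMonomials (x ⊗ y) (σ ∘ τ)
  _⊗-mapsMonomials_ {x} x↦σ y↦τ =
    mapsMonomials λ v e → trans (⟦⟧-cong x (on-δ y↦τ v) e) (on-δ x↦σ _ e)

  ^-mapsMonomials : ∀ {x} k → MapsMonomials (gen x ^ k) (raise (var x) k)
  ^-mapsMonomials {x} k = mapsMonomials (power k)
    where
    power : ∀ k v → ⟦ gen x ^ k ⟧ (δ v) ≐ δ (raise (var x) k v)
    power zero    v e =
      trans (*-identityˡ _) (reflexive (≡.cong (λ u → δ u e) (≡.sym (raise-zero (var x) v))))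
    power (suc k) v e = begin
      shift (var x) (⟦ gen x ^ k ⟧ (δ v)) e          ≈⟨ shift-cong (var x) (power k v) e ⟩
      shift (var x) (δ (raise (var x) k v)) e        ≡⟨ shift-δ (var x) (raise (var x) k v) e ⟩
      δ (updateAt (raise (var x) k v) (var x) suc) e
                                                     ≡⟨ ≡.cong (λ u → δ u e) (raise-suc (var x) k v) ⟩
      δ (raise (var x) (suc k) v) e                  ∎

  poly : Term → Coeffs n
  poly x = ⟦ x ⟧ (δ (replicate n 0))

  poly-sound : ∀ {x y} → x ≋ y → poly x ≐ poly y
  poly-sound x≋y = ⟦⟧-sound x≋y _

  module _ {mon : Vec ℕ n → Term} (poly-mon : ∀ v → poly (mon v) ≐ δ v) where

    poly-mon-diag : ∀ v → poly (mon v) v ≈ 1#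
    poly-mon-diag v = trans (poly-mon v v) (reflexive (δ-diag v))

    poly-mon-off-diag : ∀ {v w} → v ≢ w → poly (mon v) w ≈ 0#
    poly-mon-off-diag {v} {w} v≢w = trans (poly-mon v w) (reflexive (δ-off-diag v w v≢w))

    poly-lincomb-absent : ∀ m idx cs w → (∀ k → idx k ≢ w) → poly (lincomb mon m idx cs) w ≈ 0#
    poly-lincomb-absent zero    idx cs w absent = zeroˡ _
    poly-lincomb-absent (suc m) idx cs w absent = begin
      cs zero * poly (mon (idx zero)) w + poly (lincomb mon m _ _) w
        ≈⟨ +-cong (*-congˡ (poly-mon-off-diag (absent zero)))
                  (poly-lincomb-absent m (idx ∘ suc) (cs ∘ suc) w (absent ∘ suc)) ⟩
      cs zero * 0# + 0# ≈⟨ +-identityʳ _ ⟩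
      cs zero * 0#      ≈⟨ zeroʳ _ ⟩
      0#                ∎

    poly-lincomb-at : ∀ m idx → Injective _≡_ _≡_ idx →
                      ∀ cs k → poly (lincomb mon m idx cs) (idx k) ≈ cs k
    poly-lincomb-at (suc m) idx idx-inj cs zero = begin
      cs zero * poly (mon (idx zero)) (idx zero) + poly (lincomb mon m _ _) (idx zero)
        ≈⟨ +-cong (*-congˡ (poly-mon-diag (idx zero)))
                  (poly-lincomb-absent m (idx ∘ suc) (cs ∘ suc) (idx zero) (λ k → (λ ()) ∘ idx-inj)) ⟩
      cs zero * 1# + 0# ≈⟨ +-identityʳ _ ⟩
      cs zero * 1#      ≈⟨ *-identityʳ _ ⟩
      cs zero           ∎
    poly-lincomb-at (suc m) idx idx-inj cs (suc k) = begin
      cs zero * poly (mon (idx zero)) (idx (suc k)) + poly (lincomb mon m _ _) (idx (suc k))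
        ≈⟨ +-cong (*-congˡ (poly-mon-off-diag ((λ ()) ∘ idx-inj)))
                  (poly-lincomb-at m (idx ∘ suc) (Fin.suc-injective ∘ idx-inj) (cs ∘ suc) k) ⟩
      cs zero * 0# + cs (suc k) ≈⟨ +-congʳ (zeroʳ _) ⟩
      0# + cs (suc k)           ≈⟨ +-identityˡ _ ⟩
      cs (suc k)                ∎

    linearlyIndependent : LinearlyIndependent mon
    linearlyIndependent m idx idx-inj cs lincomb≋0 k = begin
      cs k                                ≈⟨ poly-lincomb-at m idx idx-inj cs k ⟨
      poly (lincomb mon m idx cs) (idx k) ≈⟨ poly-sound lincomb≋0 (idx k) ⟩
      0# * δ (replicate n 0) (idx k)      ≈⟨ zeroˡ _ ⟩
      0#                                  ∎

module _ {c ℓ} (F : Field c ℓ) (β γ γ* ϱ ϱ* : Field.Carrier F) where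
  open Presentation F β γ γ* ϱ ϱ*
  open CoefficientFunctions (Field.commutativeRing F) using (_≐_; δ)

  A-first A*-first : Gen → Fin 6
  A-first  (𝐀 i)  = i ↑ˡ 3
  A-first  (𝐀* i) = 3 ↑ʳ i
  A*-first (𝐀 i)  = 3 ↑ʳ i
  A*-first (𝐀* i) = i ↑ˡ 3

  module A-first  = PolynomialModel F β γ γ* ϱ ϱ* A-first
  module A*-first = PolynomialModel F β γ γ* ϱ ϱ* A*-first

  poly-mon₁ : ∀ v → A-first.poly (mon₁ v) ≐ δ v
  poly-mon₁ (h ∷ i ∷ j ∷ r ∷ s ∷ t ∷ []) =
    on-δ (pow h ∙ pow i ∙ pow j ∙ pow r ∙ pow s ∙ pow t) (replicate 6 0)
    where open A-first using (on-δ)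
                       renaming (^-mapsMonomials to pow; _⊗-mapsMonomials_ to _∙_)

  poly-mon₂ : ∀ v → A*-first.poly (mon₂ v) ≐ δ v
  poly-mon₂ (h ∷ i ∷ j ∷ r ∷ s ∷ t ∷ []) =
    on-δ (pow h ∙ pow i ∙ pow j ∙ pow r ∙ pow s ∙ pow t) (replicate 6 0)
    where open A*-first using (on-δ)
                        renaming (^-mapsMonomials to pow; _⊗-mapsMonomials_ to _∙_)

lemma4p7 : ∀ {c ℓ} (F : Field c ℓ) (β γ γ* ϱ ϱ* : Field.Carrier F) →
    let open Presentation F β γ γ* ϱ ϱ* in
      LinearlyIndependent mon₁ × LinearlyIndependent mon₂
lemma4p7 F β γ γ* ϱ ϱ* =
  A-first.linearlyIndependent F β γ γ* ϱ ϱ* (poly-mon₁ F β γ γ* ϱ ϱ*) ,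
  A*-first.linearlyIndependent F β γ γ* ϱ ϱ* (poly-mon₂ F β γ γ* ϱ ϱ*)
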